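{- For every finite simple graph $G$, $$\mathrm{cw}(G)\geqslant \frac14\,\delta(G)^2+\frac12\,\delta(G).$$
   Context: Cutwidth: for a graph $G=(V,E)$ and a linear ordering $\mathcal{O}=(x_1<\cdots<x_n)$ of $V$, set $\mathrm{cw}(G,\mathcal{O})=\max_{1\leqslant i\leqslant n}\#\{uv\in E : u\leqslant x_i<v\}$, and $\mathrm{cw}(G)=\min_{\mathcal{O}}\mathrm{cw}(G,\mathcal{O})$ over all linear orderings of $V$. Degeneracy: for an integer $k$, the $k$-core of $G$ is the subgraph obtained by recursively deleting vertices of degree strictly less than $k$; the degeneracy $\delta(G)$ is the largest $k$ such that the $k$-core of $G$ is nonempty. -}

module Defs where

open import Data.Nat using (ℕ; zero; suc; _+_; _⊔_; _≤ᵇ_; _<ᵇ_)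
open import Data.Bool using (Bool; true; false; _∧_; _∨_; if_then_else_; T)
open import Data.Fin using (Fin; toℕ) renaming (zero to fzero; suc to fsuc)
open import Data.Fin.Permutation using (Permutation′; _⟨$⟩ʳ_)
open import Relation.Binary.PropositionalEquality using (_≡_)

record Graph : Set where
  field
    n      : ℕ
    adj    : Fin n → Fin n → Bool
    sym    : ∀ u v → adj u v ≡ adj v u
    irrefl : ∀ v → adj v v ≡ false
open Graph public

sumFin : (m : ℕ) → (Fin m → ℕ) → ℕ
sumFin zero    f = 0
sumFin (suc m) f = f fzero + sumFin m (λ i → f (fsuc i))

maxFin : (m : ℕ) → (Fin m → ℕ) → ℕ
maxFin zero    f = 0
maxFin (suc m) f = f fzero ⊔ maxFin m (λ i → f (fsuc i))

anyFin : (m : ℕ) → (Fin m → Bool) → Bool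
anyFin zero    f = false
anyFin (suc m) f = f fzero ∨ anyFin m (λ i → f (fsuc i))

-- A linear ordering of V is a bijection V ≃ positions {0,…,n-1};
-- π ⟨$⟩ʳ v is the position of vertex v (so x_i is the vertex at position i).
Ordering : Graph → Set
Ordering G = Permutation′ (n G)

pos : (G : Graph) → Ordering G → Fin (n G) → ℕ
pos G π v = toℕ (π ⟨$⟩ʳ v)

-- Number of edges uv with u ≤ x_i < v (each edge counted once, oriented by the order).
cut : (G : Graph) → Ordering G → ℕ → ℕ
cut G π i = sumFin (n G) λ u → sumFin (n G) λ v →
  if adj G u v ∧ (pos G π u ≤ᵇ i) ∧ (i <ᵇ pos G π v) then 1 else 0

cwOrd : (G : Graph) → Ordering G → ℕ
cwOrd G π = maxFin (n G) λ i → cut G π (toℕ i)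

Subset : Graph → Set
Subset G = Fin (n G) → Bool

degIn : (G : Graph) → Subset G → Fin (n G) → ℕ
degIn G S v = sumFin (n G) λ u → if S u ∧ adj G v u then 1 else 0

coreStep : (G : Graph) → ℕ → Subset G → Subset G
coreStep G k S v = S v ∧ (k ≤ᵇ degIn G S v)

iterate : {A : Set} → (A → A) → ℕ → A → A
iterate f zero    a = a
iterate f (suc m) a = f (iterate f m a)

-- The k-core: recursive deletion; after n rounds the process has stabilised
-- (each non-stable round removes at least one of the n vertices).
core : (G : Graph) → ℕ → Subset G
core G k = iterate (coreStep G k) (n G) (λ _ → true)

coreNonempty : (G : Graph) → ℕ → Bool
coreNonempty G k = anyFin (n G) (core G k)

-- Degeneracy: largest k with nonempty k-core (searched over k ≤ n, since the
-- k-core is empty for k ≥ n); convention δ = 0 if none (only the empty graph).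
degenSearch : (G : Graph) → ℕ → ℕ
degenSearch G zero    = 0
degenSearch G (suc k) = if coreNonempty G (suc k) then suc k else degenSearch G k

degeneracy : Graph → ℕ
degeneracy G = degenSearch G (n G)

module Submission where

-- Fix a linear ordering π and put δ = δ(G); for δ = 0 there is
-- nothing to prove.  Otherwise the peeling process defining the δ-core
-- stabilises at a nonempty vertex set C in which every vertex has at least δ
-- neighbours inside C.  Split δ = j + a with j = ⌈δ/2⌉ and a = ⌊δ/2⌋.  The
-- number of vertices of C at positions ≤ i grows by at most one per position
-- and finally exceeds δ, so it equals j at some position i.  Each of these j
-- vertices has at most j - 1 neighbours of C to its left, hence at least a + 1
-- to its right, so at least j(a+1) edges cross the cut after position i, and
-- 4j(a+1) ≥ δ² + 2δ.

open import Defs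
open import Data.Nat using (ℕ; zero; suc; _+_; _*_; _≤_; _<_; _∸_; _≤ᵇ_; _<ᵇ_; _≡ᵇ_; z≤n; s≤s; pred; >-nonZero)
open import Data.Nat.Properties
open import Data.Nat.Tactic.RingSolver using (solve-∀)
open import Data.Bool using (Bool; true; false; _∧_; not; if_then_else_; T)
open import Data.Bool.Properties using (T-∧)
open import Data.Unit using (tt)
open import Data.Empty using (⊥-elim)
open import Data.Fin using (Fin; toℕ; fromℕ<) renaming (zero to fzero; suc to fsuc)
open import Data.Fin.Properties using (toℕ-injective; toℕ-fromℕ<; toℕ<n; any?) renaming (suc-injective to fsuc-injective)
open import Data.Fin.Permutation using (_⟨$⟩ʳ_; _⟨$⟩ˡ_; inverseˡ)
open import Data.Product using (Σ; ∃; _×_; _,_; proj₁; proj₂)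
open import Data.Sum using (_⊎_; inj₁; inj₂)
open import Function.Bundles using (Equivalence)
open import Relation.Nullary using (¬_; yes; no)
open import Relation.Nullary.Decidable using (T?)
open import Relation.Binary.PropositionalEquality as ≡ using (_≡_; refl; trans; cong; cong₂; subst)

∧-elim : ∀ x {y} → T (x ∧ y) → T x × T y
∧-elim x = Equivalence.to (T-∧ {x})

∧-intro : ∀ x {y} → T x → T y → T (x ∧ y)
∧-intro x tx ty = Equivalence.from (T-∧ {x}) (tx , ty)

not-elim : ∀ {x} → T (not x) → ¬ T x
not-elim {false} _ ()

not-intro : ∀ {x} → ¬ T x → T (not x)
not-intro {false} _ = tt
not-intro {true} ¬x = ¬x tt

ind : Bool → ℕ
ind b = if b then 1 else 0

count : (m : ℕ) → (Fin m → Bool) → ℕ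
count m p = sumFin m (λ i → ind (p i))

_⊆_ : ∀ {m} → (Fin m → Bool) → (Fin m → Bool) → Set
p ⊆ q = ∀ i → T (p i) → T (q i)

ind-true : ∀ {b} → T b → ind b ≡ 1
ind-true {true} _ = refl

ind-false : ∀ {b} → ¬ T b → ind b ≡ 0
ind-false {false} _ = refl
ind-false {true} ¬b = ⊥-elim (¬b tt)

ind-mono : ∀ {x y} → (T x → T y) → ind x ≤ ind y
ind-mono {false} _ = z≤n
ind-mono {true} {true} _ = ≤-refl
ind-mono {true} {false} x⇒y = ⊥-elim (x⇒y tt)

ind-< : ∀ {x y} → ¬ T x → T y → ind x < ind y
ind-< {false} {true} _ _ = s≤s z≤n
ind-< {true} ¬x _ = ⊥-elim (¬x tt)

ind-cover : ∀ {x y z} → (T x → T y ⊎ T z) → ind x ≤ ind y + ind z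
ind-cover {false} _ = z≤n
ind-cover {true} {true} _ = s≤s z≤n
ind-cover {true} {false} {true} _ = ≤-refl
ind-cover {true} {false} {false} cover with cover tt
... | inj₁ ()
... | inj₂ ()

ind-split : ∀ b x → ind b ≡ ind (b ∧ x) + ind (b ∧ not x)
ind-split false x = refl
ind-split true false = refl
ind-split true true = refl

ind-* : ∀ {b} c {r} → (T b → c ≤ r) → ind b * c ≤ r
ind-* {false} c _ = z≤n
ind-* {true} c b⇒c≤r = subst (_≤ _) (≡.sym (+-identityʳ c)) (b⇒c≤r tt)

sum-cong : ∀ m {f g : Fin m → ℕ} → (∀ i → f i ≡ g i) → sumFin m f ≡ sumFin m g
sum-cong zero _ = refl
sum-cong (suc m) f≡g = cong₂ _+_ (f≡g fzero) (sum-cong m (λ i → f≡g (fsuc i)))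

sum-mono : ∀ m {f g : Fin m → ℕ} → (∀ i → f i ≤ g i) → sumFin m f ≤ sumFin m g
sum-mono zero _ = z≤n
sum-mono (suc m) f≤g = +-mono-≤ (f≤g fzero) (sum-mono m (λ i → f≤g (fsuc i)))

sum-+ : ∀ m (f g : Fin m → ℕ) → sumFin m (λ i → f i + g i) ≡ sumFin m f + sumFin m g
sum-+ zero f g = refl
sum-+ (suc m) f g = begin
  f fzero + g fzero + sumFin m (λ i → f (fsuc i) + g (fsuc i))
    ≡⟨ cong (f fzero + g fzero +_) (sum-+ m (λ i → f (fsuc i)) (λ i → g (fsuc i))) ⟩
  f fzero + g fzero + (sumFin m (λ i → f (fsuc i)) + sumFin m (λ i → g (fsuc i)))
    ≡⟨ middle-swap (f fzero) (g fzero) _ _ ⟩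
  f fzero + sumFin m (λ i → f (fsuc i)) + (g fzero + sumFin m (λ i → g (fsuc i))) ∎
  where
  open ≡.≡-Reasoning
  middle-swap : ∀ a b c d → a + b + (c + d) ≡ a + c + (b + d)
  middle-swap = solve-∀

sum-*ʳ : ∀ m (f : Fin m → ℕ) c → sumFin m (λ i → f i * c) ≡ sumFin m f * c
sum-*ʳ zero f c = refl
sum-*ʳ (suc m) f c =
  trans (cong (f fzero * c +_) (sum-*ʳ m (λ i → f (fsuc i)) c)) (≡.sym (*-distribʳ-+ c (f fzero) _))

sum-mono-< : ∀ m {f g : Fin m → ℕ} → (∀ i → f i ≤ g i) → (u : Fin m) → f u < g u →
  sumFin m f < sumFin m g
sum-mono-< (suc m) f≤g fzero fu<gu = +-mono-≤ fu<gu (sum-mono m (λ i → f≤g (fsuc i)))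
sum-mono-< (suc m) {f} f≤g (fsuc u) fu<gu =
  ≤-trans (≤-reflexive (≡.sym (+-suc (f fzero) _)))
          (+-mono-≤ (f≤g fzero) (sum-mono-< m (λ i → f≤g (fsuc i)) u fu<gu))

sum-≥ : ∀ m (f : Fin m → ℕ) (i : Fin m) → f i ≤ sumFin m f
sum-≥ (suc m) f fzero = m≤m+n _ _
sum-≥ (suc m) f (fsuc i) = ≤-trans (sum-≥ m (λ j → f (fsuc j)) i) (m≤n+m _ _)

maxFin-≥ : ∀ m (f : Fin m → ℕ) (i : Fin m) → f i ≤ maxFin m f
maxFin-≥ (suc m) f fzero = m≤m⊔n _ _
maxFin-≥ (suc m) f (fsuc i) = ≤-trans (maxFin-≥ m (λ j → f (fsuc j)) i) (m≤n⊔m _ _)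

count-mono : ∀ m {p q : Fin m → Bool} → p ⊆ q → count m p ≤ count m q
count-mono m p⊆q = sum-mono m (λ i → ind-mono (p⊆q i))

count-all : ∀ m → count m (λ _ → true) ≡ m
count-all zero = refl
count-all (suc m) = cong suc (count-all m)

count-none : ∀ m {p : Fin m → Bool} → (∀ i → ¬ T (p i)) → count m p ≡ 0
count-none zero _ = refl
count-none (suc m) none = cong₂ _+_ (ind-false (none fzero)) (count-none m (λ i → none (fsuc i)))

count-pos : ∀ m {p : Fin m → Bool} (w : Fin m) → T (p w) → 0 < count m p
count-pos m w pw = ≤-trans (≤-reflexive (≡.sym (ind-true pw))) (sum-≥ m _ w)

count-split : ∀ m (p x : Fin m → Bool) →
  count m p ≡ count m (λ i → p i ∧ x i) + count m (λ i → p i ∧ not (x i))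
count-split m p x = trans (sum-cong m (λ i → ind-split (p i) (x i))) (sum-+ m _ _)

count-unique : ∀ m {p : Fin m → Bool} → (∀ a b → T (p a) → T (p b) → a ≡ b) → count m p ≤ 1
count-unique zero _ = z≤n
count-unique (suc m) {p} unique with T? (p fzero)
... | yes p0 = ≤-reflexive (cong₂ _+_ (ind-true p0) (count-none m (λ i pi → fzero≢fsuc (unique _ _ p0 pi))))
  where
  fzero≢fsuc : ∀ {i : Fin m} → ¬ fzero ≡ fsuc i
  fzero≢fsuc ()
... | no ¬p0 = ≤-trans (≤-reflexive (cong (_+ count m (λ i → p (fsuc i))) (ind-false ¬p0)))
                       (count-unique m (λ a b pa pb → fsuc-injective (unique _ _ pa pb)))

count-shrink : ∀ m {p q : Fin m → Bool} → p ⊆ q → q ⊆ p ⊎ count m p < count m q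
count-shrink m {p} {q} p⊆q with any? (λ i → T? (q i ∧ not (p i)))
... | yes (u , new) = inj₂ (sum-mono-< m (λ i → ind-mono (p⊆q i)) u
                              (ind-< (not-elim (proj₂ (∧-elim (q u) new))) (proj₁ (∧-elim (q u) new))))
... | no none = inj₁ q⊆p
  where
  q⊆p : q ⊆ p
  q⊆p i qi with T? (p i)
  ... | yes pi = pi
  ... | no ¬pi = ⊥-elim (none (i , ∧-intro (q i) qi (not-intro ¬pi)))

anyFin-witness : ∀ m (f : Fin m → Bool) → T (anyFin m f) → ∃ λ v → T (f v)
anyFin-witness (suc m) f any with f fzero in f0
... | true = fzero , subst T (≡.sym f0) tt
... | false with anyFin-witness m (λ i → f (fsuc i)) any
...   | v , fv = fsuc v , fv

ivt : (L : ℕ → ℕ) (j : ℕ) → (∀ i → L (suc i) ≤ suc (L i)) →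
  ∀ N → L 0 ≤ j → j ≤ L N → ∃ λ i → i ≤ N × L i ≡ j
ivt L j step zero L0≤j j≤LN = 0 , z≤n , ≤-antisym L0≤j j≤LN
ivt L j step (suc N) L0≤j j≤LN with j ≤? L N
... | yes j≤LN' with ivt L j step N L0≤j j≤LN'
...   | i , i≤N , Li≡j = i , m≤n⇒m≤1+n i≤N , Li≡j
ivt L j step (suc N) L0≤j j≤LN | no j≰LN = suc N , ≤-refl , ≤-antisym (≤-trans (step N) (≰⇒> j≰LN)) j≤LN

MinDegree : (G : Graph) → Subset G → ℕ → Set
MinDegree G C k = ∀ v → T (C v) → k ≤ degIn G C v

module Peeling (G : Graph) (k : ℕ) where

  stage : ℕ → Subset G
  stage t = iterate (coreStep G k) t (λ _ → true)

  stage-shrinks : ∀ t → stage (suc t) ⊆ stage t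
  stage-shrinks t v v∈ = proj₁ (∧-elim (stage t v) v∈)

  stage-antitone : ∀ t d → stage (d + t) ⊆ stage t
  stage-antitone t zero v v∈ = v∈
  stage-antitone t (suc d) v v∈ = stage-antitone t d v (stage-shrinks (d + t) v v∈)

  stable⇒minDegree : ∀ t → stage t ⊆ stage (suc t) → MinDegree G (stage t) k
  stable⇒minDegree t stable v v∈ = ≤ᵇ⇒≤ k _ (proj₂ (∧-elim (stage t v) (stable v v∈)))

  progress : ∀ t → (∃ λ s → s < t × stage s ⊆ stage (suc s)) ⊎ count (n G) (stage t) + t ≤ n G
  progress zero = inj₂ (≤-reflexive (trans (+-identityʳ _) (count-all (n G))))
  progress (suc t) with progress t
  ... | inj₁ (s , s<t , stable) = inj₁ (s , m≤n⇒m≤1+n s<t , stable)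
  ... | inj₂ bound with count-shrink (n G) (stage-shrinks t)
  ...   | inj₁ stable = inj₁ (t , ≤-refl , stable)
  ...   | inj₂ smaller = inj₂ (≤-trans (≤-reflexive (+-suc _ t)) (≤-trans (+-monoˡ-≤ t smaller) bound))

  core-minDegree : T (coreNonempty G k) → Σ (Subset G) λ C → MinDegree G C k × ∃ λ w → T (C w)
  core-minDegree nonempty with anyFin-witness (n G) (stage (n G)) nonempty | progress (n G)
  ... | w , w∈core | inj₂ bound =
    ⊥-elim (<-irrefl refl (≤-trans (+-monoˡ-≤ (n G) (count-pos (n G) w w∈core)) bound))
  ... | w , w∈core | inj₁ (s , s<n , stable) =
    stage s , stable⇒minDegree s stable , w ,
    stage-antitone s (n G ∸ s) w (subst (λ t → T (stage t w)) (≡.sym (m∸n+n≡m (<⇒≤ s<n))) w∈core)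

cut≤cwOrd : (G : Graph) (π : Ordering G) → ∀ i → i < n G → cut G π i ≤ cwOrd G π
cut≤cwOrd G π i i<n =
  subst (λ t → cut G π t ≤ cwOrd G π) (toℕ-fromℕ< i<n) (maxFin-≥ (n G) _ (fromℕ< i<n))

module CutBound (G : Graph) (π : Ordering G) (C : Subset G) where

  P : Fin (n G) → ℕ
  P = pos G π

  pos-injective : ∀ u v → P u ≡ P v → u ≡ v
  pos-injective u v eq =
    trans (≡.sym (inverseˡ π)) (trans (cong (π ⟨$⟩ˡ_) (toℕ-injective eq)) (inverseˡ π))

  prefix : ℕ → ℕ
  prefix i = count (n G) (λ u → C u ∧ (P u ≤ᵇ i))

  prefix-zero : prefix 0 ≤ 1
  prefix-zero = ≤-trans (count-mono (n G) (λ u t → proj₂ (∧-elim (C u) t)))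
    (count-unique (n G) (λ u v pu pv → pos-injective u v (trans (at0 pu) (≡.sym (at0 pv)))))
    where
    at0 : ∀ {u} → T (P u ≤ᵇ 0) → P u ≡ 0
    at0 t = n≤0⇒n≡0 (≤ᵇ⇒≤ _ 0 t)

  -- Only the vertex at position i + 1 can join the prefix.
  prefix-step : ∀ i → prefix (suc i) ≤ suc (prefix i)
  prefix-step i = begin
    prefix (suc i)
      ≤⟨ sum-mono (n G) (λ u → ind-cover (joins u)) ⟩
    sumFin (n G) (λ u → ind (C u ∧ (P u ≤ᵇ i)) + ind (P u ≡ᵇ suc i))
      ≡⟨ sum-+ (n G) _ _ ⟩
    prefix i + count (n G) (λ u → P u ≡ᵇ suc i)
      ≤⟨ +-monoʳ-≤ (prefix i) (count-unique (n G) (λ u v pu pv →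
           pos-injective u v (trans (≡ᵇ⇒≡ _ _ pu) (≡.sym (≡ᵇ⇒≡ _ _ pv))))) ⟩
    prefix i + 1
      ≡⟨ +-comm (prefix i) 1 ⟩
    suc (prefix i) ∎
    where
    open ≤-Reasoning
    joins : ∀ u → T (C u ∧ (P u ≤ᵇ suc i)) → T (C u ∧ (P u ≤ᵇ i)) ⊎ T (P u ≡ᵇ suc i)
    joins u t with ∧-elim (C u) t
    ... | u∈C , le with m≤n⇒m<n∨m≡n (≤ᵇ⇒≤ (P u) (suc i) le)
    ...   | inj₁ lt = inj₁ (∧-intro (C u) u∈C (≤⇒≤ᵇ (m<1+n⇒m≤n lt)))
    ...   | inj₂ eq = inj₂ (≡⇒≡ᵇ (P u) (suc i) eq)

  leftDeg rightDeg : Fin (n G) → ℕ → ℕ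
  leftDeg u i = count (n G) (λ v → (C v ∧ adj G u v) ∧ (P v ≤ᵇ i))
  rightDeg u i = count (n G) (λ v → (C v ∧ adj G u v) ∧ not (P v ≤ᵇ i))

  degIn-split : ∀ u i → degIn G C u ≡ leftDeg u i + rightDeg u i
  degIn-split u i = count-split (n G) (λ v → C v ∧ adj G u v) (λ v → P v ≤ᵇ i)

  -- A vertex of the prefix is counted there but is not its own neighbour.
  leftDeg<prefix : ∀ u i → T (C u) → P u ≤ i → leftDeg u i < prefix i
  leftDeg<prefix u i u∈C u≤i =
    sum-mono-< (n G) (λ v → ind-mono forget-adj) u (ind-< no-loop (∧-intro (C u) u∈C (≤⇒≤ᵇ u≤i)))
    where
    forget-adj : ∀ {v} → T ((C v ∧ adj G u v) ∧ (P v ≤ᵇ i)) → T (C v ∧ (P v ≤ᵇ i))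
    forget-adj {v} t with ∧-elim (C v ∧ adj G u v) t
    ... | nbr , left = ∧-intro (C v) (proj₁ (∧-elim (C v) nbr)) left
    no-loop : ¬ T ((C u ∧ adj G u u) ∧ (P u ≤ᵇ i))
    no-loop t = subst T (irrefl G u) (proj₂ (∧-elim (C u) (proj₁ (∧-elim (C u ∧ adj G u u) t))))

  all-left : ∀ v → P v ≤ pred (n G)
  all-left v = suc[m]≤n⇒m≤pred[n] (toℕ<n (π ⟨$⟩ʳ v))

  -- Edges from u crossing the cut after position i; cut G π i sums these over u.
  crossing : Fin (n G) → ℕ → ℕ
  crossing u i = count (n G) (λ v → adj G u v ∧ (P u ≤ᵇ i) ∧ (i <ᵇ P v))

  rightDeg≤crossing : ∀ u i → P u ≤ i → rightDeg u i ≤ crossing u i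
  rightDeg≤crossing u i u≤i = count-mono (n G) crosses
    where
    crosses : ∀ v → T ((C v ∧ adj G u v) ∧ not (P v ≤ᵇ i)) → T (adj G u v ∧ (P u ≤ᵇ i) ∧ (i <ᵇ P v))
    crosses v t with ∧-elim (C v ∧ adj G u v) t
    ... | nbr , right = ∧-intro (adj G u v) (proj₂ (∧-elim (C v) nbr)) (∧-intro (P u ≤ᵇ i) (≤⇒≤ᵇ u≤i)
                          (<⇒<ᵇ (≰⇒> (λ (v≤i : P v ≤ i) → not-elim right (≤⇒≤ᵇ v≤i)))))

  module _ (j a : ℕ) (minDeg : MinDegree G C (j + a)) where

    rightDeg-bound : ∀ u i → prefix i ≡ j → T (C u) → P u ≤ i → suc a ≤ rightDeg u i
    rightDeg-bound u i prefix≡j u∈C u≤i = +-cancelˡ-≤ j (suc a) _ (begin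
      j + suc a                          ≡⟨ +-suc j a ⟩
      suc (j + a)                        ≤⟨ s≤s (minDeg u u∈C) ⟩
      suc (degIn G C u)                  ≡⟨ cong suc (degIn-split u i) ⟩
      suc (leftDeg u i) + rightDeg u i   ≤⟨ +-monoˡ-≤ _ (subst (leftDeg u i <_) prefix≡j (leftDeg<prefix u i u∈C u≤i)) ⟩
      j + rightDeg u i                   ∎)
      where open ≤-Reasoning

    cut-bound : ∀ i → prefix i ≡ j → j * suc a ≤ cut G π i
    cut-bound i prefix≡j = begin
      j * suc a                                            ≡⟨ cong (_* suc a) (≡.sym prefix≡j) ⟩
      prefix i * suc a                                     ≡⟨ ≡.sym (sum-*ʳ (n G) _ (suc a)) ⟩
      sumFin (n G) (λ u → ind (C u ∧ (P u ≤ᵇ i)) * suc a)  ≤⟨ sum-mono (n G) leaving ⟩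
      cut G π i                                            ∎
      where
      open ≤-Reasoning
      leaving : ∀ u → ind (C u ∧ (P u ≤ᵇ i)) * suc a ≤ crossing u i
      leaving u = ind-* (suc a) λ t →
        let u∈C , le = ∧-elim (C u) t ; u≤i = ≤ᵇ⇒≤ _ _ le in
        ≤-trans (rightDeg-bound u i prefix≡j u∈C u≤i) (rightDeg≤crossing u i u≤i)

    -- The last prefix is all of C, which has more than j + a vertices.
    prefix-reaches : ∀ w → T (C w) → j ≤ prefix (pred (n G))
    prefix-reaches w w∈C = begin
      j                                  ≤⟨ m≤m+n j a ⟩
      j + a                              ≤⟨ minDeg w w∈C ⟩
      degIn G C w                        ≡⟨ degIn-split w last ⟩
      leftDeg w last + rightDeg w last   ≡⟨ cong (leftDeg w last +_) rightDeg-last ⟩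
      leftDeg w last + 0                 ≡⟨ +-identityʳ _ ⟩
      leftDeg w last                     <⟨ leftDeg<prefix w last w∈C (all-left w) ⟩
      prefix last                        ∎
      where
      open ≤-Reasoning
      last = pred (n G)
      rightDeg-last : rightDeg w last ≡ 0
      rightDeg-last = count-none (n G) (λ v t → not-elim (proj₂ (∧-elim (C v ∧ adj G w v) t)) (≤⇒≤ᵇ (all-left v)))

    -- The prefix count passes through j at some position, giving the bound on cw.
    cw-bound : ∀ w → T (C w) → 1 ≤ j → j * suc a ≤ cwOrd G π
    cw-bound w w∈C 1≤j
      with ivt prefix j prefix-step (pred (n G)) (≤-trans prefix-zero 1≤j) (prefix-reaches w w∈C)
    ... | i , i≤last , prefix≡j =
      ≤-trans (cut-bound i prefix≡j) (cut≤cwOrd G π i (m≤pred[n]⇒suc[m]≤n {{nonZero}} i≤last))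
      where
      nonZero = >-nonZero (≤-<-trans z≤n (toℕ<n w))

parity : ∀ k → ∃ λ h → k ≡ h + h ⊎ k ≡ suc (h + h)
parity zero = 0 , inj₁ refl
parity (suc k) with parity k
... | h , inj₁ even = h , inj₂ (cong suc even)
... | h , inj₂ odd = suc h , inj₁ (trans (cong suc odd) (cong suc (≡.sym (+-suc h h))))

-- Splitting δ = j + a with j = ⌈δ/2⌉, a = ⌊δ/2⌋ makes 4j(a+1) at least δ² + 2δ.
balanced-split : ∀ k → ∃ λ j → ∃ λ a →
  suc k ≡ j + a × 1 ≤ j × suc k * suc k + 2 * suc k ≤ 4 * (j * suc a)
balanced-split k with parity k
... | h , inj₁ refl = suc h , h , refl , s≤s z≤n , ≤-trans (m≤m+n _ 1) (≤-reflexive (odd-square h))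
  where
  odd-square : ∀ h → suc (h + h) * suc (h + h) + 2 * suc (h + h) + 1 ≡ 4 * (suc h * suc h)
  odd-square = solve-∀
... | h , inj₂ refl = suc h , suc h , cong suc (≡.sym (+-suc h h)) , s≤s z≤n , ≤-reflexive (even-square h)
  where
  even-square : ∀ h → suc (suc (h + h)) * suc (suc (h + h)) + 2 * suc (suc (h + h))
                      ≡ 4 * (suc h * suc (suc h))
  even-square = solve-∀

degenSearch-cases : ∀ G m → degenSearch G m ≡ 0 ⊎ T (coreNonempty G (degenSearch G m))
degenSearch-cases G zero = inj₁ refl
degenSearch-cases G (suc m) with coreNonempty G (suc m) in nonempty
... | true = inj₂ (subst T (≡.sym nonempty) tt)
... | false = degenSearch-cases G m

corollary2p2 : (G : Graph) (π : Ordering G) →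
    degeneracy G * degeneracy G + 2 * degeneracy G ≤ 4 * cwOrd G π
corollary2p2 G π = bound (degeneracy G) (degenSearch-cases G (n G))
  where
  bound : ∀ δ → δ ≡ 0 ⊎ T (coreNonempty G δ) → δ * δ + 2 * δ ≤ 4 * cwOrd G π
  bound zero _ = z≤n
  bound (suc k) (inj₂ nonempty)
    with Peeling.core-minDegree G (suc k) nonempty | balanced-split k
  ... | C , minDeg , w , w∈C | j , a , δ≡j+a , 1≤j , δ²+2δ≤4j[a+1] =
    ≤-trans δ²+2δ≤4j[a+1]
      (*-monoʳ-≤ 4 (CutBound.cw-bound G π C j a (subst (MinDegree G C) δ≡j+a minDeg) w w∈C 1≤j))
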